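{- The effect algebra logic of an extensive category $\mathcal{C}$ has comprehension: the truth functor $1\colon\mathcal{C}\to\mathrm{Pred}(\mathcal{C})$ has a right adjoint $\{ -\}$, giving two successive adjoints (falsity $\dashv$ forgetful $\dashv 1\dashv\{ -\}$) to the forgetful functor (fibration) $\mathrm{Pred}(\mathcal{C})\to\mathcal{C}$. Explicitly, for $q\colon Y\to Y+Y$, $\{q\}$ is given by the pullback of $q$ along $\kappa_1\colon Y\rightarrowtail Y+Y$.
   Context: An extensive category has disjoint and universal coproducts. A predicate on $X$ is $p\colon X\to X+X$ with $\nabla\circ p=\mathrm{id}$; predicates on $X$ form an effect algebra with $1=\kappa_1$, $0=\kappa_2$, $p^\perp=[\kappa_2,\kappa_1]\circ p$ and partial sum $p\boxplus q=(\nabla+\mathrm{id})\circ b$ for a bound $b\colon X\to (X+X)+X$ with $[\mathrm{id},\kappa_2]\circ b=p$, $[[\kappa_2,\kappa_1],\kappa_2]\circ b=q$; the induced order is $p\le q$ iff $p\boxplus r=q$ for some $r$. For $f\colon X\to Y$, substitution $f^*(q)$ is the unique map with $\nabla\circ f^*(q)=\mathrm{id}$ and $(f+f)\circ f^*(q)=q\circ f$. $\mathrm{Pred}(\mathcal{C})$ is the category with predicates $p\colon X\to X+X$ as objects and as maps $p\to q$ (with $q$ on $Y$) the maps $f\colon X\to Y$ with $p\le f^*(q)$; the truth functor sends $X$ to $\kappa_1\colon X\to X+X$. Here $\boxplus$ denotes the partial sum operation. -}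

module Defs where

open import Level using (Level; _⊔_; suc)
open import Data.Product using (Σ; Σ-syntax; _×_; _,_; ∃; proj₁)
open import Relation.Binary.PropositionalEquality using (_≡_)

record Category (o ℓ : Level) : Set (suc (o ⊔ ℓ)) where
  infixr 9 _∘_
  field
    Obj : Set o
    Hom : Obj → Obj → Set ℓ
    id  : ∀ {A} → Hom A A
    _∘_ : ∀ {A B C} → Hom B C → Hom A B → Hom A C
    assoc : ∀ {A B C D} (h : Hom C D) (g : Hom B C) (f : Hom A B) →
            (h ∘ g) ∘ f ≡ h ∘ (g ∘ f)
    identityˡ : ∀ {A B} (f : Hom A B) → id ∘ f ≡ f
    identityʳ : ∀ {A B} (f : Hom A B) → f ∘ id ≡ f

module CatNotions {o ℓ} (C : Category o ℓ) where
  open Category C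

  Unique : ∀ {A B : Obj} → (Hom A B → Set ℓ) → Set ℓ
  Unique {A} {B} P = Σ[ u ∈ Hom A B ] (P u × (∀ v → P v → v ≡ u))

  Mono : ∀ {A B} → Hom A B → Set (o ⊔ ℓ)
  Mono {A} f = ∀ {Z} (g h : Hom Z A) → f ∘ g ≡ f ∘ h → g ≡ h

  IsInitial : Obj → Set (o ⊔ ℓ)
  IsInitial I = ∀ W → Σ[ h ∈ Hom I W ] (∀ h' → h' ≡ h)

  IsPullback : ∀ {P A B X} → Hom A X → Hom B X → Hom P A → Hom P B → Set (o ⊔ ℓ)
  IsPullback {P} {A} {B} f g a b =
    (f ∘ a ≡ g ∘ b) ×
    (∀ {Q} (x : Hom Q A) (y : Hom Q B) → f ∘ x ≡ g ∘ y →
       Unique {Q} {P} (λ u → (a ∘ u ≡ x) × (b ∘ u ≡ y)))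

  IsCoproduct : ∀ {A B Z} → Hom A Z → Hom B Z → Set (o ⊔ ℓ)
  IsCoproduct {A} {B} {Z} a b =
    ∀ {W} (f : Hom A W) (g : Hom B W) →
      Unique {Z} {W} (λ h → (h ∘ a ≡ f) × (h ∘ b ≡ g))

record Coproducts {o ℓ} (C : Category o ℓ) : Set (o ⊔ ℓ) where
  open Category C
  open CatNotions C
  infixr 6 _+_
  field
    _+_ : Obj → Obj → Obj
    κ₁  : ∀ {A B} → Hom A (A + B)
    κ₂  : ∀ {A B} → Hom B (A + B)
    coproduct : ∀ {A B} → IsCoproduct (κ₁ {A} {B}) (κ₂ {A} {B})
    𝟘 : Obj
    𝟘-initial : IsInitial 𝟘

  [_,_] : ∀ {A B W} → Hom A W → Hom B W → Hom (A + B) W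
  [ f , g ] = proj₁ (coproduct f g)

  ∇ : ∀ {A} → Hom (A + A) A
  ∇ = [ id , id ]

  _⊕_ : ∀ {A B A' B'} → Hom A A' → Hom B B' → Hom (A + B) (A' + B')
  f ⊕ g = [ κ₁ ∘ f , κ₂ ∘ g ]

record Extensive {o ℓ} (C : Category o ℓ) : Set (suc (o ⊔ ℓ)) where
  open Category C
  open CatNotions C
  field
    coproducts : Coproducts C
  open Coproducts coproducts
  field
    pullback₁ : ∀ {Z X Y} (f : Hom Z (X + Y)) →
                Σ[ P ∈ Obj ] Σ[ a ∈ Hom P Z ] Σ[ b ∈ Hom P X ] IsPullback f κ₁ a b
    pullback₂ : ∀ {Z X Y} (f : Hom Z (X + Y)) →
                Σ[ P ∈ Obj ] Σ[ a ∈ Hom P Z ] Σ[ b ∈ Hom P Y ] IsPullback f κ₂ a b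
    κ₁-mono : ∀ {X Y} → Mono (κ₁ {X} {Y})
    κ₂-mono : ∀ {X Y} → Mono (κ₂ {X} {Y})
    disjoint : ∀ {P X Y} (a : Hom P X) (b : Hom P Y) →
               IsPullback (κ₁ {X} {Y}) κ₂ a b → IsInitial P
    universal : ∀ {Z X Y P₁ P₂} (f : Hom Z (X + Y))
                (a₁ : Hom P₁ Z) (b₁ : Hom P₁ X) (a₂ : Hom P₂ Z) (b₂ : Hom P₂ Y) →
                IsPullback f κ₁ a₁ b₁ → IsPullback f κ₂ a₂ b₂ → IsCoproduct a₁ a₂

module PredLogic {o ℓ} {C : Category o ℓ} (E : Extensive C) where
  open Category C
  open CatNotions C
  open Extensive E
  open Coproducts coproducts

  IsPredicate : ∀ {X} → Hom X (X + X) → Set ℓ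
  IsPredicate p = ∇ ∘ p ≡ id

  IsBound : ∀ {X} → Hom X ((X + X) + X) → Hom X (X + X) → Hom X (X + X) → Set ℓ
  IsBound b p q = ([ id , κ₂ ] ∘ b ≡ p) × ([ [ κ₂ , κ₁ ] , κ₂ ] ∘ b ≡ q)

  _⊞_≡_ : ∀ {X} → Hom X (X + X) → Hom X (X + X) → Hom X (X + X) → Set ℓ
  _⊞_≡_ {X} p q s = Σ[ b ∈ Hom X ((X + X) + X) ] (IsBound b p q × ((∇ ⊕ id) ∘ b ≡ s))

  _≤_ : ∀ {X} → Hom X (X + X) → Hom X (X + X) → Set ℓ
  _≤_ {X} p q = Σ[ r ∈ Hom X (X + X) ] (IsPredicate r × (p ⊞ r ≡ q))

  -- s is the substitution f*(q)
  IsSubst : ∀ {X Y} (f : Hom X Y) (q : Hom Y (Y + Y)) → Hom X (X + X) → Set ℓ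
  IsSubst f q s = (∇ ∘ s ≡ id) × ((f ⊕ f) ∘ s ≡ q ∘ f)

  -- f is a map p → q in Pred(C), i.e. p ≤ f*(q)
  PredHom : ∀ {X Y} → Hom X (X + X) → Hom Y (Y + Y) → Hom X Y → Set ℓ
  PredHom {X} p q f = Σ[ s ∈ Hom X (X + X) ] (IsSubst f q s × (p ≤ s))

  truth : ∀ X → Hom X (X + X)
  truth X = κ₁

  -- (P, ε) is a universal arrow from the truth functor to the predicate q,
  -- i.e. the value at q of a right adjoint {-} of truth with counit ε : 1(P) → q
  IsComprehension : ∀ {Y P} → Hom Y (Y + Y) → Hom P Y → Set (o ⊔ ℓ)
  IsComprehension {Y} {P} q ε =
    PredHom (truth P) q ε ×
    (∀ {X} (f : Hom X Y) → PredHom (truth X) q f →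
       Unique {X} {P} (λ g → ε ∘ g ≡ f))

  HasComprehension : Set (o ⊔ ℓ)
  HasComprehension =
    (∀ {Y} (q : Hom Y (Y + Y)) → IsPredicate q →
       Σ[ P ∈ Obj ] Σ[ π ∈ Hom P Y ] Σ[ π' ∈ Hom P Y ]
         (IsPullback q κ₁ π π' × IsComprehension q π))
    ×
    (∀ {Y P} (q : Hom Y (Y + Y)) → IsPredicate q → (π π' : Hom P Y) →
       IsPullback q κ₁ π π' → IsComprehension q π)

module Submission where

-- The
-- crux is that truth κ₁ is maximal among predicates: if κ₁ ⊞ r = s then
-- s = κ₁.  This is proved by extensive case analysis: the bound b of the
-- sum splits X into the parts where b lands in (X+X) and in X, and on each
-- part the sum agrees with κ₁.  Together with κ₁ ≤ κ₁ (an instance of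
-- p ⊞ 0 = p) this shows that morphisms 1(X) → q are exactly the maps f
-- with q ∘ f = κ₁ ∘ f.  For a predicate q, the two legs of a pullback
-- (π, π') of q along κ₁ coincide (apply ∇), so the universal property of
-- the pullback is literally the universal property of {q} = (P, π) as the
-- value at q of a right adjoint to the truth functor.

open import Defs
open import Data.Product using (Σ-syntax; _×_; _,_; proj₁; proj₂)
open import Relation.Binary.PropositionalEquality
  using (_≡_; refl; sym; trans; cong; module ≡-Reasoning)
open ≡-Reasoning

module Comprehension {o ℓ} {C : Category o ℓ} (E : Extensive C) where
  open Category C
  open CatNotions C
  open Extensive E
  open Coproducts coproducts
  open PredLogic E

  pullˡ : ∀ {A B D F} {x : Hom D F} {y : Hom B D} {w : Hom B F} (z : Hom A B) →
          x ∘ y ≡ w → x ∘ (y ∘ z) ≡ w ∘ z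
  pullˡ {x = x} {y} z e = trans (sym (assoc x y z)) (cong (_∘ z) e)

  β₁ : ∀ {A B W} (f : Hom A W) (g : Hom B W) → [ f , g ] ∘ κ₁ ≡ f
  β₁ f g = proj₁ (proj₁ (proj₂ (coproduct f g)))

  β₂ : ∀ {A B W} (f : Hom A W) (g : Hom B W) → [ f , g ] ∘ κ₂ ≡ g
  β₂ f g = proj₂ (proj₁ (proj₂ (coproduct f g)))

  jointly-epic : ∀ {A B Z W} {a : Hom A Z} {b : Hom B Z} → IsCoproduct a b →
                 (h k : Hom Z W) → h ∘ a ≡ k ∘ a → h ∘ b ≡ k ∘ b → h ≡ k
  jointly-epic {a = a} {b} cp h k ha hb =
    let (_ , _ , unique) = cp (h ∘ a) (h ∘ b)
    in trans (unique h (refl , refl)) (sym (unique k (sym ha , sym hb)))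

  ∘[,]-κ₁ : ∀ {A B W V} (h : Hom W V) (f : Hom A W) (g : Hom B W) →
            (h ∘ [ f , g ]) ∘ κ₁ ≡ h ∘ f
  ∘[,]-κ₁ h f g = trans (assoc h _ κ₁) (cong (h ∘_) (β₁ f g))

  ∘[,]-κ₂ : ∀ {A B W V} (h : Hom W V) (f : Hom A W) (g : Hom B W) →
            (h ∘ [ f , g ]) ∘ κ₂ ≡ h ∘ g
  ∘[,]-κ₂ h f g = trans (assoc h _ κ₂) (cong (h ∘_) (β₂ f g))

  -- Case analysis in an extensive category: two maps out of Z agree as soon
  -- as they agree on the part of Z sent into X by f and on the part sent
  -- into Y, since these pullbacks cover Z as a coproduct (universality).
  by-cases : ∀ {Z X Y W} (f : Hom Z (X + Y)) (h k : Hom Z W) →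
             (∀ {P} (a : Hom P Z) (x : Hom P X) → f ∘ a ≡ κ₁ ∘ x → h ∘ a ≡ k ∘ a) →
             (∀ {P} (a : Hom P Z) (y : Hom P Y) → f ∘ a ≡ κ₂ ∘ y → h ∘ a ≡ k ∘ a) →
             h ≡ k
  by-cases f h k on₁ on₂ =
    let (_ , a₁ , x , pb₁) = pullback₁ f
        (_ , a₂ , y , pb₂) = pullback₂ f
    in jointly-epic (universal f a₁ x a₂ y pb₁ pb₂) h k
         (on₁ a₁ x (proj₁ pb₁)) (on₂ a₂ y (proj₁ pb₂))

  ⊞-zero : ∀ {X} {p : Hom X (X + X)} → IsPredicate p → p ⊞ κ₂ ≡ p
  ⊞-zero {X} {p} p-pred = b , (left , right) , sum
    where
      e : Hom (X + X) ((X + X) + X)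
      e = [ κ₁ ∘ κ₁ , κ₂ ]
      b : Hom X ((X + X) + X)
      b = e ∘ p

      -- both [id , κ₂] and ∇ ⊕ id are left inverses of e
      retract : (h : Hom ((X + X) + X) (X + X)) → h ∘ (κ₁ ∘ κ₁) ≡ κ₁ → h ∘ κ₂ ≡ κ₂ → h ∘ e ≡ id
      retract h h₁ h₂ = jointly-epic coproduct (h ∘ e) id
        (trans (∘[,]-κ₁ h _ κ₂) (trans h₁ (sym (identityˡ κ₁))))
        (trans (∘[,]-κ₂ h _ κ₂) (trans h₂ (sym (identityˡ κ₂))))

      cancel : (h : Hom ((X + X) + X) (X + X)) → h ∘ e ≡ id → h ∘ b ≡ p
      cancel h he = trans (pullˡ p he) (identityˡ p)

      left : [ id , κ₂ ] ∘ b ≡ p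
      left = cancel _ (retract _ (trans (pullˡ κ₁ (β₁ id κ₂)) (identityˡ κ₁)) (β₂ id κ₂))

      sum : (∇ ⊕ id) ∘ b ≡ p
      sum = cancel _ (retract _ ∇⊕id-κ₁κ₁ (trans (β₂ _ _) (identityʳ κ₂)))
        where
          ∇⊕id-κ₁κ₁ : (∇ ⊕ id) ∘ (κ₁ ∘ κ₁) ≡ κ₁
          ∇⊕id-κ₁κ₁ = begin
            (∇ ⊕ id) ∘ (κ₁ ∘ κ₁)  ≡⟨ pullˡ κ₁ (β₁ _ _) ⟩
            (κ₁ ∘ ∇) ∘ κ₁          ≡⟨ assoc κ₁ ∇ κ₁ ⟩
            κ₁ ∘ (∇ ∘ κ₁)          ≡⟨ cong (κ₁ ∘_) (β₁ id id) ⟩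
            κ₁ ∘ id                ≡⟨ identityʳ κ₁ ⟩
            κ₁                     ∎

      right : [ [ κ₂ , κ₁ ] , κ₂ ] ∘ b ≡ κ₂
      right = begin
        [ [ κ₂ , κ₁ ] , κ₂ ] ∘ b  ≡⟨ pullˡ p swap-e ⟩
        (κ₂ ∘ ∇) ∘ p              ≡⟨ assoc κ₂ ∇ p ⟩
        κ₂ ∘ (∇ ∘ p)              ≡⟨ cong (κ₂ ∘_) p-pred ⟩
        κ₂ ∘ id                   ≡⟨ identityʳ κ₂ ⟩
        κ₂                        ∎
        where
          swap-e : [ [ κ₂ , κ₁ ] , κ₂ ] ∘ e ≡ κ₂ ∘ ∇
          swap-e = jointly-epic coproduct _ _
            (begin
              ([ [ κ₂ , κ₁ ] , κ₂ ] ∘ e) ∘ κ₁  ≡⟨ ∘[,]-κ₁ _ _ κ₂ ⟩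
              [ [ κ₂ , κ₁ ] , κ₂ ] ∘ (κ₁ ∘ κ₁) ≡⟨ pullˡ κ₁ (β₁ _ _) ⟩
              [ κ₂ , κ₁ ] ∘ κ₁                 ≡⟨ β₁ κ₂ κ₁ ⟩
              κ₂                               ≡⟨ sym (identityʳ κ₂) ⟩
              κ₂ ∘ id                          ≡⟨ cong (κ₂ ∘_) (sym (β₁ id id)) ⟩
              κ₂ ∘ (∇ ∘ κ₁)                    ≡⟨ sym (assoc κ₂ ∇ κ₁) ⟩
              (κ₂ ∘ ∇) ∘ κ₁                    ∎)
            (begin
              ([ [ κ₂ , κ₁ ] , κ₂ ] ∘ e) ∘ κ₂  ≡⟨ ∘[,]-κ₂ _ _ κ₂ ⟩
              [ [ κ₂ , κ₁ ] , κ₂ ] ∘ κ₂        ≡⟨ β₂ _ κ₂ ⟩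
              κ₂                               ≡⟨ sym (identityʳ κ₂) ⟩
              κ₂ ∘ id                          ≡⟨ cong (κ₂ ∘_) (sym (β₂ id id)) ⟩
              κ₂ ∘ (∇ ∘ κ₂)                    ≡⟨ sym (assoc κ₂ ∇ κ₂) ⟩
              (κ₂ ∘ ∇) ∘ κ₂                    ∎)

  ≤-refl : ∀ {X} {p : Hom X (X + X)} → IsPredicate p → p ≤ p
  ≤-refl p-pred = κ₂ , β₂ id id , ⊞-zero p-pred

  -- Split along the
  -- bound b: where b lands in X + X its first component is κ₁ ∘ -, where b
  -- lands in the last summand X it already agrees with [id , κ₂] ∘ b = κ₁.
  truth-⊞ : ∀ {X} {r s : Hom X (X + X)} → κ₁ ⊞ r ≡ s → s ≡ κ₁
  truth-⊞ (b , (b-left , _) , b-sum) =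
    trans (sym b-sum) (by-cases b ((∇ ⊕ id) ∘ b) κ₁ on-sum on-rest)
    where
      on-sum : ∀ {P} (a : Hom P _) (x : Hom P _) → b ∘ a ≡ κ₁ ∘ x →
               ((∇ ⊕ id) ∘ b) ∘ a ≡ κ₁ ∘ a
      on-sum a x ba = begin
        ((∇ ⊕ id) ∘ b) ∘ a  ≡⟨ assoc _ b a ⟩
        (∇ ⊕ id) ∘ (b ∘ a)  ≡⟨ cong ((∇ ⊕ id) ∘_) ba ⟩
        (∇ ⊕ id) ∘ (κ₁ ∘ x) ≡⟨ pullˡ x (β₁ _ _) ⟩
        (κ₁ ∘ ∇) ∘ x        ≡⟨ assoc κ₁ ∇ x ⟩
        κ₁ ∘ (∇ ∘ x)        ≡⟨ cong (λ t → κ₁ ∘ (∇ ∘ t)) x≡κ₁a ⟩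
        κ₁ ∘ (∇ ∘ (κ₁ ∘ a)) ≡⟨ cong (κ₁ ∘_) (pullˡ a (β₁ id id)) ⟩
        κ₁ ∘ (id ∘ a)       ≡⟨ cong (κ₁ ∘_) (identityˡ a) ⟩
        κ₁ ∘ a              ∎
        where
          x≡κ₁a : x ≡ κ₁ ∘ a
          x≡κ₁a = begin
            x                       ≡⟨ sym (identityˡ x) ⟩
            id ∘ x                  ≡⟨ sym (pullˡ x (β₁ id κ₂)) ⟩
            [ id , κ₂ ] ∘ (κ₁ ∘ x)  ≡⟨ cong ([ id , κ₂ ] ∘_) (sym ba) ⟩
            [ id , κ₂ ] ∘ (b ∘ a)   ≡⟨ pullˡ a b-left ⟩
            κ₁ ∘ a                  ∎

      on-rest : ∀ {P} (a : Hom P _) (y : Hom P _) → b ∘ a ≡ κ₂ ∘ y →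
                ((∇ ⊕ id) ∘ b) ∘ a ≡ κ₁ ∘ a
      on-rest a y ba = begin
        ((∇ ⊕ id) ∘ b) ∘ a     ≡⟨ assoc _ b a ⟩
        (∇ ⊕ id) ∘ (b ∘ a)     ≡⟨ cong ((∇ ⊕ id) ∘_) ba ⟩
        (∇ ⊕ id) ∘ (κ₂ ∘ y)    ≡⟨ pullˡ y (β₂ _ _) ⟩
        (κ₂ ∘ id) ∘ y          ≡⟨ cong (_∘ y) (identityʳ κ₂) ⟩
        κ₂ ∘ y                 ≡⟨ sym (pullˡ y (β₂ id κ₂)) ⟩
        [ id , κ₂ ] ∘ (κ₂ ∘ y) ≡⟨ cong ([ id , κ₂ ] ∘_) (sym ba) ⟩
        [ id , κ₂ ] ∘ (b ∘ a)  ≡⟨ pullˡ a b-left ⟩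
        κ₁ ∘ a                 ∎

  truth-maximal : ∀ {X} {s : Hom X (X + X)} → κ₁ ≤ s → s ≡ κ₁
  truth-maximal (_ , _ , κ₁⊞r≡s) = truth-⊞ κ₁⊞r≡s

  truth-hom⇒holds : ∀ {X Y} {q : Hom Y (Y + Y)} (f : Hom X Y) →
                    PredHom (truth X) q f → q ∘ f ≡ κ₁ ∘ f
  truth-hom⇒holds {q = q} f (s , (_ , f⊕f∘s) , κ₁≤s) = begin
    q ∘ f             ≡⟨ sym f⊕f∘s ⟩
    (f ⊕ f) ∘ s       ≡⟨ cong ((f ⊕ f) ∘_) (truth-maximal κ₁≤s) ⟩
    (f ⊕ f) ∘ κ₁      ≡⟨ β₁ _ _ ⟩
    κ₁ ∘ f            ∎

  holds⇒truth-hom : ∀ {X Y} {q : Hom Y (Y + Y)} (f : Hom X Y) →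
                    q ∘ f ≡ κ₁ ∘ f → PredHom (truth X) q f
  holds⇒truth-hom f qf =
    κ₁ , (β₁ id id , trans (β₁ _ _) (sym qf)) , ≤-refl (β₁ id id)

  pullback-legs-equal : ∀ {Y P} {q : Hom Y (Y + Y)} → IsPredicate q →
                        (π π' : Hom P Y) → q ∘ π ≡ κ₁ ∘ π' → π ≡ π'
  pullback-legs-equal {q = q} q-pred π π' square = begin
    π               ≡⟨ sym (identityˡ π) ⟩
    id ∘ π          ≡⟨ cong (_∘ π) (sym q-pred) ⟩
    (∇ ∘ q) ∘ π     ≡⟨ assoc ∇ q π ⟩
    ∇ ∘ (q ∘ π)     ≡⟨ cong (∇ ∘_) square ⟩
    ∇ ∘ (κ₁ ∘ π')   ≡⟨ pullˡ π' (β₁ id id) ⟩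
    id ∘ π'         ≡⟨ identityˡ π' ⟩
    π'              ∎

  pullback-comprehension : ∀ {Y P} (q : Hom Y (Y + Y)) → IsPredicate q →
                           (π π' : Hom P Y) → IsPullback q κ₁ π π' →
                           IsComprehension q π
  pullback-comprehension q q-pred π π' (square , universal-pb) =
    holds⇒truth-hom π (trans square (cong (κ₁ ∘_) (sym π≡π'))) , mediate
    where
      π≡π' : π ≡ π'
      π≡π' = pullback-legs-equal q-pred π π' square

      mediate : ∀ {X} (f : Hom X _) → PredHom (truth X) q f →
                Unique (λ g → π ∘ g ≡ f)
      mediate f f-hom =
        let (u , (πu , _) , unique) = universal-pb f f (truth-hom⇒holds f f-hom)
        in u , πu , λ v πv → unique v (πv , trans (cong (_∘ v) (sym π≡π')) πv)

  comprehension-exists : ∀ {Y} (q : Hom Y (Y + Y)) → IsPredicate q →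
                         Σ[ P ∈ Obj ] Σ[ π ∈ Hom P Y ] Σ[ π' ∈ Hom P Y ]
                           (IsPullback q κ₁ π π' × IsComprehension q π)
  comprehension-exists q q-pred =
    let (P , π , π' , pb) = pullback₁ q
    in P , π , π' , pb , pullback-comprehension q q-pred π π' pb

proposition6p2 : ∀ {o ℓ} {C : Category o ℓ} (E : Extensive C) →
                 PredLogic.HasComprehension E
proposition6p2 E = comprehension-exists , pullback-comprehension
  where open Comprehension E
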